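{- Let $\mathbf{I}$ (with set of histories $H$) and $\mathbf{I}'$ (with set of histories $H'$) be super-additive DTDS interpreted frames, and let $\pi:H'\to H$ be a surjective p-morphism from $\mathbf{I}'$ to $\mathbf{I}$. Then for every valuation $V:\mathsf{Prop}\to\wp(H\times\mathbb{N})$ there is a valuation $V':\mathsf{Prop}\to\wp(H'\times\mathbb{N})$ such that for every $(h',t)\in H'\times\mathbb{N}$ and every formula $\varphi\in\mathcal{L}_{\mathrm{DTDS}}$, $\varphi$ is true in $(\mathbf{I},V)$ at $(\pi(h'),t)$ iff $\varphi$ is true in $(\mathbf{I}',V')$ at $(h',t)$.
   Context: Fix a finite non-empty set of agents $\mathsf{Agt}$ and a countably infinite set $\mathsf{Prop}$ of propositional variables. $\mathcal{L}_{\mathrm{DTDS}}$: $\varphi::=p\mid\neg\varphi\mid(\varphi\land\varphi)\mid\Box\varphi\mid[i]\varphi\mid[\mathsf{Agt}]\varphi\mid\mathsf{O}_i\varphi\mid\mathsf{X}\varphi\mid\mathsf{U}(\varphi,\varphi)$. A super-additive DTDS interpreted frame is a tuple $(H,R_\Box,\{R_{[i]},R_{\mathsf{O}_i}\mid i\in\mathsf{Agt}\},R_{\mathsf{Agt}})$ with $H$ non-empty, $R_\Box$ and each $R_{[i]}$ equivalence relations on $H\times\mathbb{N}$, $R_{\mathsf{O}_i}$ and $R_{\mathsf{Agt}}$ binary relations on $H\times\mathbb{N}$, satisfying: (D0) $(h,t)R_\Box(h',t')$ implies $t=t'$; (D1) $R_{[i]}\subseteq R_\Box$; (D2) for every $R_\Box$-class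 $M$ and every choice of an $R_{[i]}$-class $f(i)\subseteq M$ for each $i$, $\bigcap_i f(i)\ne\varnothing$; (D3*) $R_{\mathsf{Agt}}\subseteq\bigcap_{i}R_{[i]}$; (D4) $(h,t+1)R_\Box(h',t+1)$ implies $(h,t)R_{\mathsf{Agt}}(h',t)$; (D5) $R_{\mathsf{O}_i}\subseteq R_\Box$; (D6) $R_{\mathsf{O}_i}$ serial; (D7) $R_{\mathsf{O}_i}\circ R_{[i]}\subseteq R_{\mathsf{O}_i}$; (D8) $R_\Box\circ R_{\mathsf{O}_i}\subseteq R_{\mathsf{O}_i}$, where $x(R\circ R')y$ iff $xRz$ and $zR'y$ for some $z$. A valuation is $V:\mathsf{Prop}\to\wp(H\times\mathbb{N})$. Truth at $(h,t)$ in (frame, valuation): $p$ iff $(h,t)\in V(p)$; Boolean clauses as usual; $O\varphi$ (for $O\in\{\Box,[\mathsf{Agt}],[i],\mathsf{O}_i\}$, with relation $R_O$, $R_{[\mathsf{Agt}]}=R_{\mathsf{Agt}}$) iff $\varphi$ true at all $R_O$-successors of $(h,t)$; $\mathsf{X}\varphi$ iff $\varphi$ true at $(h,t+1)$; $\mathsf{U}(\varphi,\psi)$ iff for some $t'\ge t$, $\varphi$ true at $(h,t')$ and $\psi$ true at $(h,t'')$ for all $t\le t''<t'$. A p-morphism from $\mathbf{I}'$ (histories $H'$, relations $R'_O$) to $\mathbf{I}$ (histories $H$, relations $R_O$) is a function $\pi:H'\to H$ such that for every $t\in\mathbb{N}$ and every $O\in\{\Box,[\mathsf{Agt}]\}\cup\{[i],\mathsf{O}_i\mid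 i\in\mathsf{Agt}\}$: (forth) if $(g,t)R'_O(h,t)$ then $(\pi(g),t)R_O(\pi(h),t)$; (back) if $(\pi(g),t)R_O(k,t)$ for some $k\in H$, then there is $h\in H'$ with $\pi(h)=k$ and $(g,t)R'_O(h,t)$. -}

module Defs where

open import Level using (0ℓ)
open import Data.Nat using (ℕ; suc; _≤_; _<_)
open import Data.Fin using (Fin)
open import Data.Product using (_×_; _,_; Σ; ∃)
open import Relation.Binary using (Rel; IsEquivalence)
open import Relation.Binary.PropositionalEquality using (_≡_)
open import Function.Bundles using (_⇔_)
open import Data.Empty using (⊥)

Agt : ℕ → Set
Agt n = Fin (suc n)

PropVar : Set
PropVar = ℕ

data Form (n : ℕ) : Set where
  var   : PropVar → Form n
  ¬'_   : Form n → Form n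
  _∧'_  : Form n → Form n → Form n
  □     : Form n → Form n
  [_]   : Agt n → Form n → Form n
  [Agt] : Form n → Form n
  O     : Agt n → Form n → Form n
  X     : Form n → Form n
  U     : Form n → Form n → Form n

record Frame (n : ℕ) : Set₁ where
  field
    H     : Set
    inhab : H
    RBox  : Rel (H × ℕ) 0ℓ
    RInd  : Agt n → Rel (H × ℕ) 0ℓ
    RObl  : Agt n → Rel (H × ℕ) 0ℓ
    RAgt  : Rel (H × ℕ) 0ℓ
    RBox-equiv : IsEquivalence RBox
    RInd-equiv : ∀ i → IsEquivalence (RInd i)
    D0 : ∀ {h t h' t'} → RBox (h , t) (h' , t') → t ≡ t'
    D1 : ∀ i {x y} → RInd i x y → RBox x y
    -- (D2) independence of agents: any choice of one [i]-class inside the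
    -- □-class M of m (given by representatives f i ∈ M) has non-empty
    -- intersection.
    D2 : ∀ (m : H × ℕ) (f : Agt n → H × ℕ) → (∀ i → RBox m (f i)) →
         ∃ λ (x : H × ℕ) → ∀ i → RInd i (f i) x
    D3 : ∀ {x y} → RAgt x y → ∀ i → RInd i x y
    D4 : ∀ {h h' t} → RBox (h , suc t) (h' , suc t) → RAgt (h , t) (h' , t)
    D5 : ∀ i {x y} → RObl i x y → RBox x y
    D6 : ∀ i x → ∃ λ y → RObl i x y
    D7 : ∀ i {x y z} → RObl i x z → RInd i z y → RObl i x y
    D8 : ∀ i {x y z} → RBox x z → RObl i z y → RObl i x y

data Op (n : ℕ) : Set where
  opBox : Op n
  opAgt : Op n
  opInd : Agt n → Op n
  opObl : Agt n → Op n

module _ {n : ℕ} (F : Frame n) where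
  open Frame F

  rel : Op n → Rel (H × ℕ) 0ℓ
  rel opBox     = RBox
  rel opAgt     = RAgt
  rel (opInd i) = RInd i
  rel (opObl i) = RObl i

  Valuation : Set₁
  Valuation = PropVar → H × ℕ → Set

  Sat : Valuation → H → ℕ → Form n → Set
  Sat V h t (var p)   = V p (h , t)
  Sat V h t (¬' φ)    = Sat V h t φ → ⊥
  Sat V h t (φ ∧' ψ)  = Sat V h t φ × Sat V h t ψ
  Sat V h t (□ φ)     = ∀ h' t' → RBox (h , t) (h' , t') → Sat V h' t' φ
  Sat V h t ([ i ] φ) = ∀ h' t' → RInd i (h , t) (h' , t') → Sat V h' t' φ
  Sat V h t ([Agt] φ) = ∀ h' t' → RAgt (h , t) (h' , t') → Sat V h' t' φ
  Sat V h t (O i φ)   = ∀ h' t' → RObl i (h , t) (h' , t') → Sat V h' t' φ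
  Sat V h t (X φ)     = Sat V h (suc t) φ
  Sat V h t (U φ ψ)   = Σ ℕ λ t' → t ≤ t' × Sat V h t' φ ×
                          (∀ t'' → t ≤ t'' → t'' < t' → Sat V h t'' ψ)

record IsPMorphism {n : ℕ} (I' I : Frame n) (π : Frame.H I' → Frame.H I) : Set where
  field
    forth : ∀ (o : Op n) (t : ℕ) (g h : Frame.H I') →
            rel I' o (g , t) (h , t) → rel I o (π g , t) (π h , t)
    back  : ∀ (o : Op n) (t : ℕ) (g : Frame.H I') (k : Frame.H I) →
            rel I o (π g , t) (k , t) →
            ∃ λ (h : Frame.H I') → π h ≡ k × rel I' o (g , t) (h , t)

Surjective : {A B : Set} → (A → B) → Set
Surjective {A} f = ∀ b → ∃ λ a → f a ≡ b

{-# OPTIONS --safe #-}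
-- Truth is preserved along any p-morphism π once propositional variables are
-- pulled back along π.  In the modal cases forth and back transfer the
-- successors of h and of π h into each other; this uses that all relations of a
-- frame are time-preserving, since the p-morphism conditions only speak about
-- moments with a common time.
module Submission where

open import Defs
open import Data.Fin using (zero)
open import Data.Nat using (ℕ; suc)
open import Data.Product using (Σ; _,_)
open import Data.Product.Function.NonDependent.Propositional using (_×-⇔_)
open import Data.Product.Function.Dependent.Propositional using (congˡ)
open import Function.Bundles using (_⇔_; mk⇔; Equivalence)
open import Function.Construct.Composition using (_⇔-∘_)
open import Function.Construct.Identity using (⇔-id)
open import Function.Related.Propositional using (equivalence)
open import Function.Related.TypeIsomorphisms using (¬-cong-⇔; →-cong-⇔)
open import Relation.Binary.PropositionalEquality using (_≡_; refl)

private
  variable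
    n : ℕ

Box : (F : Frame n) → Op n → (Frame.H F → ℕ → Set) → Frame.H F → ℕ → Set
Box F o P h t = ∀ h′ t′ → rel F o (h , t) (h′ , t′) → P h′ t′

rel-sameTime : (F : Frame n) (o : Op n) {h h′ : Frame.H F} {t t′ : ℕ} →
               rel F o (h , t) (h′ , t′) → t ≡ t′
rel-sameTime F opBox     r = D0 r                     where open Frame F
-- R_Agt ⊆ R_[i] ⊆ R_□ for any agent i, and Agt n always contains zero.
rel-sameTime F opAgt     r = D0 (D1 zero (D3 r zero)) where open Frame F
rel-sameTime F (opInd i) r = D0 (D1 i r)              where open Frame F
rel-sameTime F (opObl i) r = D0 (D5 i r)              where open Frame F

Π-cong-⇔ : {A : Set} {P Q : A → Set} → (∀ x → P x ⇔ Q x) → (∀ x → P x) ⇔ (∀ x → Q x)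
Π-cong-⇔ P⇔Q = mk⇔ (λ f x → Equivalence.to (P⇔Q x) (f x))
                   (λ f x → Equivalence.from (P⇔Q x) (f x))

Box-cong : (F : Frame n) (o : Op n) {P Q : Frame.H F → ℕ → Set} →
           (∀ h t → P h t ⇔ Q h t) → ∀ h t → Box F o P h t ⇔ Box F o Q h t
Box-cong F o P⇔Q h t =
  Π-cong-⇔ λ h′ → Π-cong-⇔ λ t′ → →-cong-⇔ (⇔-id _) (P⇔Q h′ t′)

module _ {I′ I : Frame n} {π : Frame.H I′ → Frame.H I} (pm : IsPMorphism I′ I π) where
  open IsPMorphism pm

  Box-pullback : (o : Op n) (P : Frame.H I → ℕ → Set) → ∀ h t →
                 Box I o P (π h) t ⇔ Box I′ o (λ h′ → P (π h′)) h t
  Box-pullback o P h t = mk⇔ to from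
    where
    to : Box I o P (π h) t → Box I′ o (λ h′ → P (π h′)) h t
    to s h′ t′ r with rel-sameTime I′ o r
    ... | refl = s (π h′) t (forth o t h h′ r)

    from : Box I′ o (λ h′ → P (π h′)) h t → Box I o P (π h) t
    from s k t′ r with rel-sameTime I o r
    ... | refl with back o t h k r
    ...   | h′ , refl , r′ = s h′ t r′

  pullback : Valuation I → Valuation I′
  pullback V p (h , t) = V p (π h , t)

  Sat-pullback : (V : Valuation I) → ∀ h t φ → Sat I V (π h) t φ ⇔ Sat I′ (pullback V) h t φ
  Sat-pullback V = sat
    where
    sat : ∀ h t φ → Sat I V (π h) t φ ⇔ Sat I′ (pullback V) h t φ
    modal : (o : Op n) (φ : Form n) → ∀ h t →
            Box I o (λ k t′ → Sat I V k t′ φ) (π h) t ⇔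
            Box I′ o (λ h′ t′ → Sat I′ (pullback V) h′ t′ φ) h t

    modal o φ h t = Box-cong I′ o (λ h′ t′ → sat h′ t′ φ) h t
                    ⇔-∘ Box-pullback o (λ k t′ → Sat I V k t′ φ) h t

    sat h t (var p)   = ⇔-id _
    sat h t (¬' φ)    = ¬-cong-⇔ (sat h t φ)
    sat h t (φ ∧' ψ)  = sat h t φ ×-⇔ sat h t ψ
    sat h t (□ φ)     = modal opBox φ h t
    sat h t ([ i ] φ) = modal (opInd i) φ h t
    sat h t ([Agt] φ) = modal opAgt φ h t
    sat h t (O i φ)   = modal (opObl i) φ h t
    sat h t (X φ)     = sat h (suc t) φ
    sat h t (U φ ψ)   = congˡ {k = equivalence} λ {t′} →
      ⇔-id _ ×-⇔ sat h t′ φ ×-⇔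
      Π-cong-⇔ λ t″ → →-cong-⇔ (⇔-id _) (→-cong-⇔ (⇔-id _) (sat h t″ ψ))

lemma3 : ∀ {n : ℕ} (I I' : Frame n) (π : Frame.H I' → Frame.H I) →
         IsPMorphism I' I π → Surjective π →
         ∀ (V : Valuation I) → Σ (Valuation I') λ V' →
           ∀ (h' : Frame.H I') (t : ℕ) (φ : Form n) →
             Sat I V (π h') t φ ⇔ Sat I' V' h' t φ
lemma3 I I' π pm _ V = pullback pm V , Sat-pullback pm V
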